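{- Let $q$ be a prime power, $n\ge \ell\ge 0$ integers, and let $\mathcal F\subseteq\mathbb F_q[x]$ be an $\ell$-intersecting family of monic polynomials of degree $n$ of maximum possible size (namely $|\mathcal F|=q^{n-\ell}$). Then for every irreducible monic polynomial $f\in\mathbb F_q[x]$ of degree $n-\ell$ there exists $p\in\mathcal F$ with $f\mid p$.
   Context: $\mathbb F_q$ is the finite field with $q$ elements. A family $\mathcal F\subseteq\mathbb F_q[x]$ is $\ell$-intersecting if $\deg(\gcd(p_1,p_2))\geq\ell$ for all $p_1,p_2\in\mathcal F$. -}

module Defs where

open import Level using (0ℓ)
open import Data.Nat using (ℕ; zero; suc; _≤_)
open import Data.Fin using (Fin)
open import Data.List using (List; []; _∷_; map; _++_; [_])
open import Data.List.Relation.Unary.All using (All)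
open import Data.List.Membership.Propositional using (_∈_)
open import Data.Vec using (Vec; toList)
open import Data.Product using (Σ; ∃; _×_)
open import Data.Sum using (_⊎_)
open import Relation.Nullary using (¬_)
open import Relation.Binary.PropositionalEquality using (_≡_)
open import Algebra.Structures using (IsCommutativeRing)
open import Function.Bundles using (_↔_)

record FiniteField (q : ℕ) : Set₁ where
  field
    Carrier : Set
    _+_ _*_ : Carrier → Carrier → Carrier
    -_      : Carrier → Carrier
    0# 1#   : Carrier
    isCommutativeRing : IsCommutativeRing _≡_ _+_ _*_ -_ 0# 1#
    0≢1     : ¬ (0# ≡ 1#)
    inverse : ∀ x → ¬ (x ≡ 0#) → ∃ λ y → (x * y) ≡ 1#
    enum    : Fin q ↔ Carrier

-- Univariate polynomials over F, as coefficient lists (constant term first).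
module PolyOver {q : ℕ} (F : FiniteField q) where
  open FiniteField F

  Poly : Set
  Poly = List Carrier

  _+ₚ_ : Poly → Poly → Poly
  [] +ₚ g = g
  (a ∷ f) +ₚ [] = a ∷ f
  (a ∷ f) +ₚ (b ∷ g) = (a + b) ∷ (f +ₚ g)

  _*ₚ_ : Poly → Poly → Poly
  [] *ₚ g = []
  (a ∷ f) *ₚ g = map (a *_) g +ₚ (0# ∷ (f *ₚ g))

  -- equality of polynomials: coefficientwise, up to trailing zeros
  _≈ₚ_ : Poly → Poly → Set
  [] ≈ₚ g = All (_≡ 0#) g
  (a ∷ f) ≈ₚ [] = All (_≡ 0#) (a ∷ f)
  (a ∷ f) ≈ₚ (b ∷ g) = (a ≡ b) × (f ≈ₚ g)

  0ₚ 1ₚ : Poly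
  0ₚ = []
  1ₚ = [ 1# ]

  _∣ₚ_ : Poly → Poly → Set
  f ∣ₚ g = Σ Poly λ h → (f *ₚ h) ≈ₚ g

  IsUnit : Poly → Set
  IsUnit u = Σ Poly λ v → (u *ₚ v) ≈ₚ 1ₚ

  Irreducible : Poly → Set
  Irreducible f = ¬ (f ≈ₚ 0ₚ) × ¬ IsUnit f ×
                  (∀ g h → f ≈ₚ (g *ₚ h) → IsUnit g ⊎ IsUnit h)

  -- the monic polynomial of degree n with lower coefficients c₀,…,c_{n-1}
  monic : ∀ {n} → Vec Carrier n → Poly
  monic c = toList c ++ [ 1# ]

  IsMonicGCD : ∀ {k} → Vec Carrier k → Poly → Poly → Set
  IsMonicGCD d p₁ p₂ = (monic d ∣ₚ p₁) × (monic d ∣ₚ p₂) ×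
                       (∀ e → e ∣ₚ p₁ → e ∣ₚ p₂ → e ∣ₚ monic d)

  DegGcd≥ : ℕ → Poly → Poly → Set
  DegGcd≥ ℓ p₁ p₂ = ∀ k (d : Vec Carrier k) → IsMonicGCD d p₁ p₂ → ℓ ≤ k

  Intersecting : ∀ {n} → ℕ → List (Vec Carrier n) → Set
  Intersecting ℓ 𝓕 = ∀ {p₁ p₂} → p₁ ∈ 𝓕 → p₂ ∈ 𝓕 → DegGcd≥ ℓ (monic p₁) (monic p₂)

{-# OPTIONS --safe #-}

-- Divide every p ∈ 𝓕 by f. If no remainder vanished, the q ^ (n ∸ ℓ) members of 𝓕 would have
-- remainders among the q ^ (n ∸ ℓ) − 1 nonzero polynomials of degree < n ∸ ℓ, so two distinct
-- members p₁, p₂ would share one, i.e. f ∣ p₁ − p₂. Their monic gcd d has degree ≥ ℓ and divides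
-- p₁ − p₂ as well; f ∤ d because f ∤ p₁, so the irreducible f is coprime to d and f d ∣ p₁ − p₂.
-- But p₁ − p₂ is nonzero of degree < n, whereas deg (f d) ≥ (n ∸ ℓ) + ℓ = n.

module Submission where

open import Defs
open import Level using (0ℓ; _⊔_)
open import Algebra.Bundles using (CommutativeRing)
open import Data.Nat as ℕ using (ℕ; zero; suc; _≤_; _<_; _∸_; _^_; z≤n; s≤s)
open import Data.Nat.Properties as ℕ using (≤-refl; ≤-trans)
open import Data.List as List using (List; []; _∷_; map; [_]; length)
open import Data.List.Relation.Unary.All as All using (All; []; _∷_)
open import Data.List.Relation.Unary.Any using (Any; any?)
open import Data.List.Relation.Unary.Unique.Propositional using (Unique; _∷_)
open import Data.List.Membership.Propositional using (_∈_; find; lose)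
open import Data.List.Membership.Propositional.Properties using (∈-lookup)
open import Data.Vec using (Vec; []; _∷_; toList)
open import Data.Product using (Σ; ∃; ∃₂; _×_; _,_; proj₁; proj₂)
open import Data.Sum using (inj₁; inj₂)
open import Function using (_∘_)
open import Function.Bundles using (Inverse)
open import Data.Fin as Fin using (Fin)
import Data.Fin.Properties as Fin
open import Relation.Binary.Definitions using (DecidableEquality)
open import Relation.Nullary using (¬_; Dec; yes; no; contradiction)
open import Relation.Nullary.Decidable using (map′)
open import Relation.Binary.PropositionalEquality as ≡ using (_≡_; _≢_)

module CommutativeRingDivisibility {c ℓ} (R : CommutativeRing c ℓ) where
  open CommutativeRing R
  open import Algebra.Properties.Ring ring
    using (-‿distribʳ-*; x[y-z]≈xy-xz; xyx⁻¹≈y; -‿+-comm; //-rightDividesˡ)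
  open import Algebra.Properties.CommutativeSemigroup +-commutativeSemigroup using (interchange)
  open import Algebra.Properties.Magma.Divisibility *-magma using (_∣ˡ_; _,_)
  open import Algebra.Solver.Ring.NaturalCoefficients.Default commutativeSemiring
  open import Relation.Binary.Reasoning.Setoid setoid

  LinearCombination : Carrier → Carrier → Carrier → Set (c ⊔ ℓ)
  LinearCombination x y d = ∃₂ λ u v → d ≈ u * x + v * y

  Coprime : Carrier → Carrier → Set (c ⊔ ℓ)
  Coprime x y = LinearCombination x y 1#

  x≈y+z⇒x-y≈z : ∀ {x y z} → x ≈ y + z → x - y ≈ z
  x≈y+z⇒x-y≈z {x} {y} {z} x≈y+z = trans (+-congʳ x≈y+z) (xyx⁻¹≈y y z)

  x-bt≈bq+r⇒x≈b[t+q]+r : ∀ {x b t q r} → x - b * t ≈ b * q + r → x ≈ b * (t + q) + r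
  x-bt≈bq+r⇒x≈b[t+q]+r {x} {b} {t} {q} {r} x-bt≈bq+r = begin
    x                    ≈⟨ //-rightDividesˡ (b * t) x ⟨
    (x - b * t) + b * t  ≈⟨ +-congʳ x-bt≈bq+r ⟩
    (b * q + r) + b * t  ≈⟨ solve 4 (λ b t q r → (b :* q :+ r) :+ b :* t := b :* (t :+ q) :+ r)
                                    refl b t q r ⟩
    b * (t + q) + r      ∎

  x≈y*u⇒x*v≈y : ∀ {x y u v} → u * v ≈ 1# → x ≈ y * u → x * v ≈ y
  x≈y*u⇒x*v≈y {x} {y} {u} {v} uv≈1 x≈yu = begin
    x * v        ≈⟨ *-congʳ x≈yu ⟩
    y * u * v    ≈⟨ *-assoc y u v ⟩
    y * (u * v)  ≈⟨ *-congˡ uv≈1 ⟩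
    y * 1#       ≈⟨ *-identityʳ y ⟩
    y            ∎

  combinationˡ : ∀ x y → LinearCombination x y x
  combinationˡ x y = 1# , 0# , solve 2 (λ x y → x := con 1 :* x :+ con 0 :* y) refl x y

  combinationʳ : ∀ x y → LinearCombination x y y
  combinationʳ x y = 0# , 1# , solve 2 (λ x y → y := con 0 :* x :+ con 1 :* y) refl x y

  combination-*ʳ : ∀ {x y d} z → LinearCombination x y d → LinearCombination x y (d * z)
  combination-*ʳ {x} {y} {d} z (u , v , d≈ux+vy) = u * z , v * z , (begin
    d * z                      ≈⟨ *-congʳ d≈ux+vy ⟩
    (u * x + v * y) * z        ≈⟨ solve 5 (λ u v x y z → (u :* x :+ v :* y) :* z
                                                     := (u :* z) :* x :+ (v :* z) :* y) refl u v x y z ⟩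
    (u * z) * x + (v * z) * y  ∎)

  combination-resp : ∀ {x y d d′} → d ≈ d′ → LinearCombination x y d → LinearCombination x y d′
  combination-resp d≈d′ (u , v , d≈ux+vy) = u , v , trans (sym d≈d′) d≈ux+vy

  combination-remainder : ∀ {x y a d q r} → LinearCombination x y a → LinearCombination x y d →
                          a ≈ d * q + r → LinearCombination x y r
  combination-remainder {x} {y} {a} {d} {q} {r} (u₁ , v₁ , a≈) (u₂ , v₂ , d≈) a≈dq+r =
    u₁ + u₂ * - q , v₁ + v₂ * - q , (begin
    r                                            ≈⟨ x≈y+z⇒x-y≈z a≈dq+r ⟨
    a - d * q                                    ≈⟨ +-congˡ (-‿distribʳ-* d q) ⟩
    a + d * - q                                  ≈⟨ +-cong a≈ (*-congʳ d≈) ⟩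
    (u₁ * x + v₁ * y) + (u₂ * x + v₂ * y) * - q  ≈⟨ solve 7 (λ u₁ v₁ u₂ v₂ x y n →
                                                       (u₁ :* x :+ v₁ :* y) :+ (u₂ :* x :+ v₂ :* y) :* n
                                                    := (u₁ :+ u₂ :* n) :* x :+ (v₁ :+ v₂ :* n) :* y)
                                                    refl u₁ v₁ u₂ v₂ x y (- q) ⟩
    (u₁ + u₂ * - q) * x + (v₁ + v₂ * - q) * y    ∎)

  ∣ˡ-− : ∀ {e x y} → e ∣ˡ x → e ∣ˡ y → e ∣ˡ x - y
  ∣ˡ-− {e} {x} {y} (s , es≈x) (t , et≈y) =
    s - t , trans (x[y-z]≈xy-xz e s t) (+-cong es≈x (-‿cong et≈y))

  ∣ˡ-combination : ∀ {e x y d} → e ∣ˡ x → e ∣ˡ y → LinearCombination x y d → e ∣ˡ d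
  ∣ˡ-combination {e} {x} {y} {d} (s , es≈x) (t , et≈y) (u , v , d≈ux+vy) = u * s + v * t , (begin
    e * (u * s + v * t)        ≈⟨ solve 5 (λ e u v s t → e :* (u :* s :+ v :* t)
                                                     := u :* (e :* s) :+ v :* (e :* t)) refl e u v s t ⟩
    u * (e * s) + v * (e * t)  ≈⟨ +-cong (*-congˡ es≈x) (*-congˡ et≈y) ⟩
    u * x + v * y              ≈⟨ d≈ux+vy ⟨
    d                          ∎)

  zero-remainder⇒∣ˡ : ∀ {a b q r} → a ≈ b * q + r → r ≈ 0# → b ∣ˡ a
  zero-remainder⇒∣ˡ {a} {b} {q} {r} a≈bq+r r≈0 = q , (begin
    b * q       ≈⟨ +-identityʳ (b * q) ⟨
    b * q + 0#  ≈⟨ +-congˡ r≈0 ⟨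
    b * q + r   ≈⟨ a≈bq+r ⟨
    a           ∎)

  ∣ˡ-remainder : ∀ {a b q r} → a ≈ b * q + r → b ∣ˡ a → b ∣ˡ r
  ∣ˡ-remainder {a} {b} {q} {r} a≈bq+r (s , bs≈a) = s - q , (begin
    b * (s - q)    ≈⟨ x[y-z]≈xy-xz b s q ⟩
    b * s - b * q  ≈⟨ +-congʳ bs≈a ⟩
    a - b * q      ≈⟨ x≈y+z⇒x-y≈z a≈bq+r ⟩
    r              ∎)

  ∣ˡ-difference : ∀ {a a′ b q q′ r} → a ≈ b * q + r → a′ ≈ b * q′ + r → b ∣ˡ a - a′
  ∣ˡ-difference {a} {a′} {b} {q} {q′} {r} a≈bq+r a′≈bq′+r = q - q′ , (begin
    b * (q - q′)                      ≈⟨ x[y-z]≈xy-xz b q q′ ⟩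
    b * q - b * q′                    ≈⟨ +-identityʳ _ ⟨
    (b * q - b * q′) + 0#             ≈⟨ +-congˡ (-‿inverseʳ r) ⟨
    (b * q - b * q′) + (r - r)        ≈⟨ interchange (b * q) (- (b * q′)) r (- r) ⟩
    (b * q + r) + (- (b * q′) + - r)  ≈⟨ +-congˡ (-‿+-comm (b * q′) r) ⟩
    (b * q + r) - (b * q′ + r)        ≈⟨ +-cong a≈bq+r (-‿cong a′≈bq′+r) ⟨
    a - a′                            ∎)

  coprime-∣ˡ⇒*∣ˡ : ∀ {x y z} → Coprime x y → x ∣ˡ z → y ∣ˡ z → x * y ∣ˡ z
  coprime-∣ˡ⇒*∣ˡ {x} {y} {z} (u , v , 1≈ux+vy) (s , xs≈z) (t , yt≈z) = u * t + v * s , (begin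
    x * y * (u * t + v * s)            ≈⟨ solve 6 (λ x y u v s t → x :* y :* (u :* t :+ v :* s)
                                                             := u :* x :* (y :* t) :+ v :* y :* (x :* s))
                                                  refl x y u v s t ⟩
    u * x * (y * t) + v * y * (x * s)  ≈⟨ +-cong (*-congˡ yt≈z) (*-congˡ xs≈z) ⟩
    u * x * z + v * y * z              ≈⟨ distribʳ z (u * x) (v * y) ⟨
    (u * x + v * y) * z                ≈⟨ *-congʳ 1≈ux+vy ⟨
    1# * z                             ≈⟨ *-identityˡ z ⟩
    z                                  ∎)

lookup-injective : ∀ {a} {A : Set a} {xs : List A} → Unique xs →
                   ∀ i j → List.lookup xs i ≡ List.lookup xs j → i ≡ j
lookup-injective (_  ∷ _)         Fin.zero    Fin.zero    _  = ≡.refl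
lookup-injective (x∉ ∷ _)         Fin.zero    (Fin.suc j) eq = contradiction eq (All.lookup x∉ (∈-lookup j))
lookup-injective (x∉ ∷ _)         (Fin.suc i) Fin.zero    eq =
  contradiction (≡.sym eq) (All.lookup x∉ (∈-lookup i))
lookup-injective (_  ∷ xs-unique) (Fin.suc i) (Fin.suc j) eq =
  ≡.cong Fin.suc (lookup-injective xs-unique i j eq)

pigeonhole-avoiding : ∀ {a} {A : Set a} {xs : List A} {k} → Unique xs → length xs ≡ k →
                      (g : A → Fin k) (z : Fin k) → All (λ x → g x ≢ z) xs →
                      ∃₂ λ x y → x ∈ xs × y ∈ xs × x ≢ y × g x ≡ g y
pigeonhole-avoiding {xs = []}        _         ≡.refl _ () _
pigeonhole-avoiding {xs = xs@(_ ∷ _)} xs-unique ≡.refl g z avoids =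
  let i , j , i<j , same = Fin.pigeonhole (ℕ.n<1+n _) (λ i → Fin.punchOut (z≢ i))
  in List.lookup xs i , List.lookup xs j , ∈-lookup i , ∈-lookup j ,
     Fin.<⇒≢ i<j ∘ lookup-injective xs-unique i j , Fin.punchOut-injective (z≢ i) (z≢ j) same
  where
  z≢ : ∀ i → z ≢ g (List.lookup xs i)
  z≢ i = All.lookup avoids (∈-lookup i) ∘ ≡.sym

module Polynomials {q : ℕ} (F : FiniteField q) where
  open import Relation.Binary.PropositionalEquality
    using (refl; sym; trans; cong; cong₂; subst; module ≡-Reasoning)
  open FiniteField F using (Carrier; 0#; 1#; 0≢1; inverse; enum)
  open PolyOver F
  open ≡-Reasoning

  fieldRing : CommutativeRing 0ℓ 0ℓ
  fieldRing = record { isCommutativeRing = FiniteField.isCommutativeRing F }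

  open CommutativeRing fieldRing
    using (_+_; _*_; -_; +-comm; +-assoc; +-identityˡ; +-identityʳ; -‿inverseˡ; -‿inverseʳ;
           *-comm; *-assoc; *-identityˡ; *-identityʳ; distribˡ; distribʳ; zeroˡ; zeroʳ)

  open import Algebra.Properties.CommutativeSemigroup (CommutativeRing.+-commutativeSemigroup fieldRing)
    using (interchange)
  open import Algebra.Properties.Ring (CommutativeRing.ring fieldRing) using (-0#≈0#)

  open Inverse enum using (to; from; strictlyInverseˡ)

  from-injective : ∀ {x y} → from x ≡ from y → x ≡ y
  from-injective {x} {y} eq = begin
    x            ≡⟨ strictlyInverseˡ x ⟨
    to (from x)  ≡⟨ cong to eq ⟩
    to (from y)  ≡⟨ strictlyInverseˡ y ⟩
    y            ∎

  _≟_ : DecidableEquality Carrier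
  x ≟ y = map′ from-injective (cong from) (from x Fin.≟ from y)

  1#≢0# : 1# ≢ 0#
  1#≢0# = 0≢1 ∘ sym

  *-nonZero : ∀ {x y} → x ≢ 0# → y ≢ 0# → x * y ≢ 0#
  *-nonZero {x} {y} x≢0 y≢0 xy≡0 with inverse x x≢0
  ... | x⁻¹ , xx⁻¹≡1 = y≢0 (begin
    y                ≡⟨ *-identityˡ y ⟨
    1# * y           ≡⟨ cong (_* y) (trans (sym xx⁻¹≡1) (*-comm x x⁻¹)) ⟩
    (x⁻¹ * x) * y    ≡⟨ *-assoc x⁻¹ x y ⟩
    x⁻¹ * (x * y)    ≡⟨ cong (x⁻¹ *_) xy≡0 ⟩
    x⁻¹ * 0#         ≡⟨ zeroʳ x⁻¹ ⟩
    0#               ∎)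

  -- The ring F[x]

  coeff : Poly → ℕ → Carrier
  coeff []      _       = 0#
  coeff (a ∷ f) zero    = a
  coeff (a ∷ f) (suc i) = coeff f i

  -- A record rather than a function of f and g, so that f and g can be inferred from f ≋ g.
  infix 4 _≋_
  record _≋_ (f g : Poly) : Set where
    constructor coeffwise
    field coeff-≡ : ∀ i → coeff f i ≡ coeff g i
  open _≋_

  ≋-refl : ∀ {f} → f ≋ f
  ≋-refl = coeffwise λ _ → refl

  ≋-sym : ∀ {f g} → f ≋ g → g ≋ f
  ≋-sym f≋g = coeffwise λ i → sym (coeff-≡ f≋g i)

  ≋-trans : ∀ {f g h} → f ≋ g → g ≋ h → f ≋ h
  ≋-trans f≋g g≋h = coeffwise λ i → trans (coeff-≡ f≋g i) (coeff-≡ g≋h i)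

  All≡0⇒coeff≡0 : ∀ {f} → All (_≡ 0#) f → ∀ i → coeff f i ≡ 0#
  All≡0⇒coeff≡0 []        _       = refl
  All≡0⇒coeff≡0 (a≡0 ∷ _)  zero    = a≡0
  All≡0⇒coeff≡0 (_ ∷ f≡0)  (suc i) = All≡0⇒coeff≡0 f≡0 i

  coeff≡0⇒All≡0 : ∀ f → (∀ i → coeff f i ≡ 0#) → All (_≡ 0#) f
  coeff≡0⇒All≡0 []      _   = []
  coeff≡0⇒All≡0 (a ∷ f) f≡0 = f≡0 zero ∷ coeff≡0⇒All≡0 f (f≡0 ∘ suc)

  ≈ₚ⇒≋ : ∀ {f g} → f ≈ₚ g → f ≋ g
  ≈ₚ⇒≋ {[]}    {g}     g≡0           = coeffwise λ i → sym (All≡0⇒coeff≡0 g≡0 i)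
  ≈ₚ⇒≋ {a ∷ f} {[]}    f≡0           = coeffwise (All≡0⇒coeff≡0 f≡0)
  ≈ₚ⇒≋ {a ∷ f} {b ∷ g} (a≡b , f≈ₚg) = coeffwise λ where
    zero    → a≡b
    (suc i) → coeff-≡ (≈ₚ⇒≋ f≈ₚg) i

  ≋⇒≈ₚ : ∀ {f g} → f ≋ g → f ≈ₚ g
  ≋⇒≈ₚ {[]}    {g}     f≋g = coeff≡0⇒All≡0 g λ i → sym (coeff-≡ f≋g i)
  ≋⇒≈ₚ {a ∷ f} {[]}    f≋g = coeff≡0⇒All≡0 (a ∷ f) (coeff-≡ f≋g)
  ≋⇒≈ₚ {a ∷ f} {b ∷ g} f≋g = coeff-≡ f≋g zero , ≋⇒≈ₚ (coeffwise (coeff-≡ f≋g ∘ suc))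

  negₚ : Poly → Poly
  negₚ = map -_

  scale : Carrier → Poly → Poly
  scale a = map (a *_)

  coeff-+ₚ : ∀ f g i → coeff (f +ₚ g) i ≡ coeff f i + coeff g i
  coeff-+ₚ []      g       i       = sym (+-identityˡ _)
  coeff-+ₚ (a ∷ f) []      i       = sym (+-identityʳ _)
  coeff-+ₚ (a ∷ f) (b ∷ g) zero    = refl
  coeff-+ₚ (a ∷ f) (b ∷ g) (suc i) = coeff-+ₚ f g i

  coeff-negₚ : ∀ f i → coeff (negₚ f) i ≡ - coeff f i
  coeff-negₚ []      i       = sym -0#≈0#
  coeff-negₚ (a ∷ f) zero    = refl
  coeff-negₚ (a ∷ f) (suc i) = coeff-negₚ f i

  coeff-scale : ∀ c f i → coeff (scale c f) i ≡ c * coeff f i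
  coeff-scale c []      i       = sym (zeroʳ c)
  coeff-scale c (a ∷ f) zero    = refl
  coeff-scale c (a ∷ f) (suc i) = coeff-scale c f i

  +ₚ-cong : ∀ {f f′ g g′} → f ≋ f′ → g ≋ g′ → f +ₚ g ≋ f′ +ₚ g′
  +ₚ-cong {f} {f′} {g} {g′} f≋f′ g≋g′ = coeffwise λ i → begin
    coeff (f +ₚ g) i          ≡⟨ coeff-+ₚ f g i ⟩
    coeff f i + coeff g i     ≡⟨ cong₂ _+_ (coeff-≡ f≋f′ i) (coeff-≡ g≋g′ i) ⟩
    coeff f′ i + coeff g′ i   ≡⟨ coeff-+ₚ f′ g′ i ⟨
    coeff (f′ +ₚ g′) i        ∎

  negₚ-cong : ∀ {f f′} → f ≋ f′ → negₚ f ≋ negₚ f′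
  negₚ-cong {f} {f′} f≋f′ = coeffwise λ i →
    trans (coeff-negₚ f i) (trans (cong -_ (coeff-≡ f≋f′ i)) (sym (coeff-negₚ f′ i)))

  scale-cong : ∀ {a f f′} → f ≋ f′ → scale a f ≋ scale a f′
  scale-cong {a} {f} {f′} f≋f′ = coeffwise λ i →
    trans (coeff-scale a f i) (trans (cong (a *_) (coeff-≡ f≋f′ i)) (sym (coeff-scale a f′ i)))

  shift-cong : ∀ {f f′} → f ≋ f′ → 0# ∷ f ≋ 0# ∷ f′
  shift-cong f≋f′ = coeffwise λ where
    zero    → refl
    (suc i) → coeff-≡ f≋f′ i

  +ₚ-comm : ∀ f g → f +ₚ g ≋ g +ₚ f
  +ₚ-comm f g = coeffwise λ i → trans (coeff-+ₚ f g i) (trans (+-comm _ _) (sym (coeff-+ₚ g f i)))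

  +ₚ-assoc : ∀ f g h → (f +ₚ g) +ₚ h ≋ f +ₚ (g +ₚ h)
  +ₚ-assoc f g h = coeffwise λ i → begin
    coeff ((f +ₚ g) +ₚ h) i                ≡⟨ coeff-+ₚ (f +ₚ g) h i ⟩
    coeff (f +ₚ g) i + coeff h i           ≡⟨ cong (_+ coeff h i) (coeff-+ₚ f g i) ⟩
    (coeff f i + coeff g i) + coeff h i    ≡⟨ +-assoc _ _ _ ⟩
    coeff f i + (coeff g i + coeff h i)    ≡⟨ cong (coeff f i +_) (coeff-+ₚ g h i) ⟨
    coeff f i + coeff (g +ₚ h) i           ≡⟨ coeff-+ₚ f (g +ₚ h) i ⟨
    coeff (f +ₚ (g +ₚ h)) i                ∎

  +ₚ-interchange : ∀ f g h k → (f +ₚ g) +ₚ (h +ₚ k) ≋ (f +ₚ h) +ₚ (g +ₚ k)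
  +ₚ-interchange f g h k = coeffwise λ i → begin
    coeff ((f +ₚ g) +ₚ (h +ₚ k)) i                     ≡⟨ coeff-+ₚ (f +ₚ g) _ i ⟩
    coeff (f +ₚ g) i + coeff (h +ₚ k) i                ≡⟨ cong₂ _+_ (coeff-+ₚ f g i) (coeff-+ₚ h k i) ⟩
    (coeff f i + coeff g i) + (coeff h i + coeff k i)  ≡⟨ interchange _ _ _ _ ⟩
    (coeff f i + coeff h i) + (coeff g i + coeff k i)  ≡⟨ cong₂ _+_ (coeff-+ₚ f h i) (coeff-+ₚ g k i) ⟨
    coeff (f +ₚ h) i + coeff (g +ₚ k) i                ≡⟨ coeff-+ₚ (f +ₚ h) _ i ⟨
    coeff ((f +ₚ h) +ₚ (g +ₚ k)) i                     ∎

  +ₚ-identityʳ : ∀ f → f +ₚ [] ≋ f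
  +ₚ-identityʳ f = coeffwise λ i → trans (coeff-+ₚ f [] i) (+-identityʳ _)

  negₚ-inverseˡ : ∀ f → negₚ f +ₚ f ≋ []
  negₚ-inverseˡ f = coeffwise λ i →
    trans (coeff-+ₚ (negₚ f) f i) (trans (cong (_+ coeff f i) (coeff-negₚ f i)) (-‿inverseˡ _))

  negₚ-inverseʳ : ∀ f → f +ₚ negₚ f ≋ []
  negₚ-inverseʳ f = ≋-trans (+ₚ-comm f (negₚ f)) (negₚ-inverseˡ f)

  scale-zero : ∀ g → scale 0# g ≋ []
  scale-zero g = coeffwise λ i → trans (coeff-scale 0# g i) (zeroˡ _)

  scale-one : ∀ g → scale 1# g ≋ g
  scale-one g = coeffwise λ i → trans (coeff-scale 1# g i) (*-identityˡ _)

  scale-distribˡ : ∀ a g h → scale a (g +ₚ h) ≋ scale a g +ₚ scale a h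
  scale-distribˡ a g h = coeffwise λ i → begin
    coeff (scale a (g +ₚ h)) i                    ≡⟨ coeff-scale a (g +ₚ h) i ⟩
    a * coeff (g +ₚ h) i                          ≡⟨ cong (a *_) (coeff-+ₚ g h i) ⟩
    a * (coeff g i + coeff h i)                   ≡⟨ distribˡ _ _ _ ⟩
    a * coeff g i + a * coeff h i                 ≡⟨ cong₂ _+_ (coeff-scale a g i) (coeff-scale a h i) ⟨
    coeff (scale a g) i + coeff (scale a h) i     ≡⟨ coeff-+ₚ (scale a g) _ i ⟨
    coeff (scale a g +ₚ scale a h) i              ∎

  scale-distribʳ : ∀ a b g → scale (a + b) g ≋ scale a g +ₚ scale b g
  scale-distribʳ a b g = coeffwise λ i → begin
    coeff (scale (a + b) g) i                     ≡⟨ coeff-scale _ g i ⟩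
    (a + b) * coeff g i                           ≡⟨ distribʳ _ _ _ ⟩
    a * coeff g i + b * coeff g i                 ≡⟨ cong₂ _+_ (coeff-scale a g i) (coeff-scale b g i) ⟨
    coeff (scale a g) i + coeff (scale b g) i     ≡⟨ coeff-+ₚ (scale a g) _ i ⟨
    coeff (scale a g +ₚ scale b g) i              ∎

  scale-scale : ∀ a b g → scale a (scale b g) ≋ scale (a * b) g
  scale-scale a b g = coeffwise λ i → begin
    coeff (scale a (scale b g)) i   ≡⟨ coeff-scale a (scale b g) i ⟩
    a * coeff (scale b g) i         ≡⟨ cong (a *_) (coeff-scale b g i) ⟩
    a * (b * coeff g i)             ≡⟨ *-assoc _ _ _ ⟨
    (a * b) * coeff g i             ≡⟨ coeff-scale (a * b) g i ⟨
    coeff (scale (a * b) g) i       ∎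

  scale-shift : ∀ a g → scale a (0# ∷ g) ≋ 0# ∷ scale a g
  scale-shift a g = coeffwise λ where
    zero    → zeroʳ a
    (suc i) → refl

  shift-+ₚ : ∀ g h → 0# ∷ (g +ₚ h) ≋ (0# ∷ g) +ₚ (0# ∷ h)
  shift-+ₚ g h = coeffwise λ where
    zero    → sym (+-identityˡ 0#)
    (suc i) → refl

  shift-[] : 0# ∷ [] ≋ []
  shift-[] = coeffwise λ where
    zero    → refl
    (suc i) → refl

  *ₚ-zeroˡ : ∀ {f} g → f ≋ [] → f *ₚ g ≋ []
  *ₚ-zeroˡ {[]}    g f≋0 = ≋-refl
  *ₚ-zeroˡ {a ∷ f} g f≋0 =
    ≋-trans (+ₚ-cong a·g≋0 (shift-cong (*ₚ-zeroˡ {f} g (coeffwise (coeff-≡ f≋0 ∘ suc))))) shift-[]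
    where
    a·g≋0 : scale a g ≋ []
    a·g≋0 = ≋-trans (subst (λ c → scale a g ≋ scale c g) (coeff-≡ f≋0 zero) ≋-refl) (scale-zero g)

  *ₚ-zeroʳ : ∀ g → g *ₚ [] ≋ []
  *ₚ-zeroʳ []      = ≋-refl
  *ₚ-zeroʳ (b ∷ g) = ≋-trans (shift-cong (*ₚ-zeroʳ g)) shift-[]

  *ₚ-congʳ : ∀ {f f′} g → f ≋ f′ → f *ₚ g ≋ f′ *ₚ g
  *ₚ-congʳ {[]}    g f≋f′ = ≋-sym (*ₚ-zeroˡ g (≋-sym f≋f′))
  *ₚ-congʳ {a ∷ f} {[]} g f≋f′ = *ₚ-zeroˡ g f≋f′
  *ₚ-congʳ {a ∷ f} {b ∷ f′} g f≋f′ =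
    +ₚ-cong (subst (λ c → scale a g ≋ scale c g) (coeff-≡ f≋f′ zero) ≋-refl)
            (shift-cong (*ₚ-congʳ {f} {f′} g (coeffwise (coeff-≡ f≋f′ ∘ suc))))

  *ₚ-congˡ : ∀ f {g g′} → g ≋ g′ → f *ₚ g ≋ f *ₚ g′
  *ₚ-congˡ []      g≋g′ = ≋-refl
  *ₚ-congˡ (a ∷ f) g≋g′ = +ₚ-cong (scale-cong g≋g′) (shift-cong (*ₚ-congˡ f g≋g′))

  *ₚ-distribʳ : ∀ g f f′ → (f +ₚ f′) *ₚ g ≋ (f *ₚ g) +ₚ (f′ *ₚ g)
  *ₚ-distribʳ g []      f′       = ≋-refl
  *ₚ-distribʳ g (a ∷ f) []       = ≋-sym (+ₚ-identityʳ _)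
  *ₚ-distribʳ g (a ∷ f) (b ∷ f′) =
    ≋-trans (+ₚ-cong (scale-distribʳ a b g)
                     (≋-trans (shift-cong (*ₚ-distribʳ g f f′)) (shift-+ₚ (f *ₚ g) (f′ *ₚ g))))
            (+ₚ-interchange (scale a g) (scale b g) (0# ∷ (f *ₚ g)) (0# ∷ (f′ *ₚ g)))

  *ₚ-distribˡ : ∀ f g g′ → f *ₚ (g +ₚ g′) ≋ (f *ₚ g) +ₚ (f *ₚ g′)
  *ₚ-distribˡ []      g g′ = ≋-refl
  *ₚ-distribˡ (a ∷ f) g g′ =
    ≋-trans (+ₚ-cong (scale-distribˡ a g g′)
                     (≋-trans (shift-cong (*ₚ-distribˡ f g g′)) (shift-+ₚ (f *ₚ g) (f *ₚ g′))))
            (+ₚ-interchange (scale a g) (scale a g′) (0# ∷ (f *ₚ g)) (0# ∷ (f *ₚ g′)))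

  *ₚ-shiftʳ : ∀ g f → g *ₚ (0# ∷ f) ≋ 0# ∷ (g *ₚ f)
  *ₚ-shiftʳ []      f = ≋-sym shift-[]
  *ₚ-shiftʳ (b ∷ g) f = coeffwise λ where
    zero    → trans (+-identityʳ _) (zeroʳ b)
    (suc i) → coeff-≡ (+ₚ-cong (≋-refl {scale b f}) (*ₚ-shiftʳ g f)) i

  *ₚ-constʳ : ∀ g a → g *ₚ [ a ] ≋ scale a g
  *ₚ-constʳ []      a = ≋-refl
  *ₚ-constʳ (b ∷ g) a = coeffwise λ where
    zero    → trans (+-identityʳ _) (*-comm b a)
    (suc i) → coeff-≡ (*ₚ-constʳ g a) i

  *ₚ-comm : ∀ f g → f *ₚ g ≋ g *ₚ f
  *ₚ-comm []      g = ≋-sym (*ₚ-zeroʳ g)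
  *ₚ-comm (a ∷ f) g = ≋-sym g·a∷f≋
    where
    a∷f≋a+x·f : a ∷ f ≋ [ a ] +ₚ (0# ∷ f)
    a∷f≋a+x·f = coeffwise λ where
      zero    → sym (+-identityʳ a)
      (suc i) → refl
    g·a∷f≋ : g *ₚ (a ∷ f) ≋ scale a g +ₚ (0# ∷ (f *ₚ g))
    g·a∷f≋ = ≋-trans (*ₚ-congˡ g a∷f≋a+x·f)
             (≋-trans (*ₚ-distribˡ g [ a ] (0# ∷ f))
             (+ₚ-cong (*ₚ-constʳ g a) (≋-trans (*ₚ-shiftʳ g f) (shift-cong (*ₚ-comm g f)))))

  scale-*ₚ : ∀ a g h → scale a g *ₚ h ≋ scale a (g *ₚ h)
  scale-*ₚ a []      h = ≋-refl
  scale-*ₚ a (b ∷ g) h =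
    ≋-trans (+ₚ-cong (≋-sym (scale-scale a b h)) (shift-cong (scale-*ₚ a g h)))
    (≋-trans (+ₚ-cong (≋-refl {scale a (scale b h)}) (≋-sym (scale-shift a (g *ₚ h))))
             (≋-sym (scale-distribˡ a (scale b h) (0# ∷ (g *ₚ h)))))

  *ₚ-assoc : ∀ f g h → (f *ₚ g) *ₚ h ≋ f *ₚ (g *ₚ h)
  *ₚ-assoc []      g h = ≋-refl
  *ₚ-assoc (a ∷ f) g h =
    ≋-trans (*ₚ-distribʳ h (scale a g) (0# ∷ (f *ₚ g)))
            (+ₚ-cong (scale-*ₚ a g h)
                     (≋-trans (+ₚ-cong (scale-zero h) ≋-refl) (shift-cong (*ₚ-assoc f g h))))

  *ₚ-identityˡ : ∀ g → [ 1# ] *ₚ g ≋ g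
  *ₚ-identityˡ g = ≋-trans (+ₚ-cong (scale-one g) shift-[]) (+ₚ-identityʳ g)

  polyRing : CommutativeRing 0ℓ 0ℓ
  polyRing = record
    { Carrier = Poly ; _≈_ = _≋_ ; _+_ = _+ₚ_ ; _*_ = _*ₚ_ ; -_ = negₚ ; 0# = [] ; 1# = [ 1# ]
    ; isCommutativeRing = record
      { isRing = record
        { +-isAbelianGroup = record
          { isGroup = record
            { isMonoid = record
              { isSemigroup = record
                { isMagma = record
                  { isEquivalence = record { refl = ≋-refl ; sym = ≋-sym ; trans = ≋-trans }
                  ; ∙-cong = +ₚ-cong }
                ; assoc = +ₚ-assoc }
              ; identity = (λ _ → ≋-refl) , +ₚ-identityʳ }
            ; inverse = negₚ-inverseˡ , negₚ-inverseʳ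
            ; ⁻¹-cong = negₚ-cong }
          ; comm = +ₚ-comm }
        ; *-cong = λ {_} {f′} {g} f≋f′ g≋g′ → ≋-trans (*ₚ-congʳ g f≋f′) (*ₚ-congˡ f′ g≋g′)
        ; *-assoc = *ₚ-assoc
        ; *-identity = *ₚ-identityˡ , λ g → ≋-trans (*ₚ-comm g [ 1# ]) (*ₚ-identityˡ g)
        ; distrib = *ₚ-distribˡ , *ₚ-distribʳ }
      ; *-comm = *ₚ-comm } }

  open import Algebra.Properties.Magma.Divisibility (CommutativeRing.*-magma polyRing)
    using (_∣ˡ_; _,_; ∣ˡ-respʳ-≈) public
  open import Algebra.Properties.Semigroup.Divisibility (CommutativeRing.*-semigroup polyRing)
    using (∣ˡ-trans)
  open CommutativeRing polyRing using () renaming (_-_ to _-ₚ_)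
  open import Algebra.Properties.Ring (CommutativeRing.ring polyRing) using (x∙y⁻¹≈ε⇒x≈y)
  open CommutativeRingDivisibility polyRing

  ∣ˡ⇒∣ₚ : ∀ {f g} → f ∣ˡ g → f ∣ₚ g
  ∣ˡ⇒∣ₚ (h , fh≋g) = h , ≋⇒≈ₚ fh≋g

  ∣ₚ⇒∣ˡ : ∀ {f g} → f ∣ₚ g → f ∣ˡ g
  ∣ₚ⇒∣ˡ (h , fh≈g) = h , ≈ₚ⇒≋ fh≈g

  -- Size

  VanishesFrom : ℕ → Poly → Set
  VanishesFrom N f = ∀ i → N ≤ i → coeff f i ≡ 0#

  -- size f is 1 + deg f, and 0 for f ≋ 0, which spares us a degree −∞.
  size : Poly → ℕ
  size []      = 0
  size (a ∷ f) with size f | a ≟ 0#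
  ... | suc k | _     = suc (suc k)
  ... | zero  | yes _ = 0
  ... | zero  | no _  = 1

  size-∷ : ∀ a {f k} → size f ≡ suc k → size (a ∷ f) ≡ suc (suc k)
  size-∷ a f≡ rewrite f≡ = refl

  size-tail : ∀ a f → size f ≤ ℕ.pred (size (a ∷ f))
  size-tail a f with size f | a ≟ 0#
  ... | suc k | _     = ≤-refl
  ... | zero  | yes _ = z≤n
  ... | zero  | no _  = z≤n

  size≤⇒coeff≡0 : ∀ f {i} → size f ≤ i → coeff f i ≡ 0#
  size≤⇒coeff≡0 []      _ = refl
  size≤⇒coeff≡0 (a ∷ f) {suc i} f≤ =
    size≤⇒coeff≡0 f (≤-trans (size-tail a f) (ℕ.pred-mono-≤ f≤))
  size≤⇒coeff≡0 (a ∷ f) {zero}  f≤ with size f | a ≟ 0#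
  ... | zero | yes a≡0 = a≡0
  size≤⇒coeff≡0 (a ∷ f) {zero} () | zero  | no _
  size≤⇒coeff≡0 (a ∷ f) {zero} () | suc _ | _

  size≡suc⇒coeff≢0 : ∀ f {k} → size f ≡ suc k → coeff f k ≢ 0#
  size≡suc⇒coeff≢0 (a ∷ f) {k} f≡ with size f in f′≡ | a ≟ 0#
  size≡suc⇒coeff≢0 (a ∷ f) {zero}  f≡   | zero  | no a≢0 = a≢0
  size≡suc⇒coeff≢0 (a ∷ f) {suc k} refl | suc j | _      = size≡suc⇒coeff≢0 f f′≡

  vanishes⇒size≤ : ∀ f {N} → VanishesFrom N f → size f ≤ N
  vanishes⇒size≤ f {N} f≡0 with size f in f≡ | N ℕ.≤? ℕ.pred (size f)
  ... | zero  | _       = z≤n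
  ... | suc k | yes N≤k = contradiction (f≡0 k N≤k) (size≡suc⇒coeff≢0 f f≡)
  ... | suc k | no N≰k  = ℕ.≰⇒> N≰k

  size≤⇒vanishes : ∀ f {N} → size f ≤ N → VanishesFrom N f
  size≤⇒vanishes f f≤N i N≤i = size≤⇒coeff≡0 f (≤-trans f≤N N≤i)

  coeff≢0⇒<size : ∀ f {k} → coeff f k ≢ 0# → k < size f
  coeff≢0⇒<size f c≢0 = ℕ.≰⇒> (c≢0 ∘ size≤⇒coeff≡0 f)

  size-exact : ∀ f {k} → VanishesFrom (suc k) f → coeff f k ≢ 0# → size f ≡ suc k
  size-exact f f≡0 c≢0 = ℕ.≤-antisym (vanishes⇒size≤ f f≡0) (coeff≢0⇒<size f c≢0)

  size-cong : ∀ {f g} → f ≋ g → size f ≡ size g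
  size-cong {f} {g} f≋g = ℕ.≤-antisym (bound f≋g) (bound (≋-sym f≋g))
    where
    bound : ∀ {f g} → f ≋ g → size f ≤ size g
    bound {f} {g} f≋g = vanishes⇒size≤ f λ i g≤i → trans (coeff-≡ f≋g i) (size≤⇒coeff≡0 g g≤i)

  size≡0⇒≋[] : ∀ f → size f ≡ 0 → f ≋ []
  size≡0⇒≋[] f f≡0 = coeffwise λ i → size≤⇒coeff≡0 f (subst (_≤ i) (sym f≡0) z≤n)

  ≉[]⇒0<size : ∀ {f} → ¬ f ≈ₚ [] → 0 < size f
  ≉[]⇒0<size {f} f≉0 = ℕ.n≢0⇒n>0 (f≉0 ∘ ≋⇒≈ₚ ∘ size≡0⇒≋[] f)

  size-scale≤ : ∀ c g → size (scale c g) ≤ size g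
  size-scale≤ c g = vanishes⇒size≤ (scale c g) λ i g≤i →
    trans (coeff-scale c g i) (trans (cong (c *_) (size≤⇒coeff≡0 g g≤i)) (zeroʳ c))

  size-scale : ∀ {c} g {k} → c ≢ 0# → size g ≡ suc k → size (scale c g) ≡ suc k
  size-scale {c} g {k} c≢0 g≡ = size-exact (scale c g)
    (size≤⇒vanishes (scale c g) (subst (size (scale c g) ≤_) g≡ (size-scale≤ c g)))
    (λ ck≡0 → *-nonZero c≢0 (size≡suc⇒coeff≢0 g g≡) (trans (sym (coeff-scale c g k)) ck≡0))

  size-+ₚ-< : ∀ f g → size f < size g → size (f +ₚ g) ≡ size g
  size-+ₚ-< f g f<g with size g in g≡
  ... | suc k = size-exact (f +ₚ g) vanishes leading
    where
    vanishes : VanishesFrom (suc k) (f +ₚ g)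
    vanishes i k<i = begin
      coeff (f +ₚ g) i       ≡⟨ coeff-+ₚ f g i ⟩
      coeff f i + coeff g i  ≡⟨ cong₂ _+_ (size≤⇒vanishes f (ℕ.<⇒≤ f<g) i k<i)
                                          (size≤⇒coeff≡0 g (subst (_≤ i) (sym g≡) k<i)) ⟩
      0# + 0#                ≡⟨ +-identityˡ 0# ⟩
      0#                     ∎
    leading : coeff (f +ₚ g) k ≢ 0#
    leading fgk≡0 = size≡suc⇒coeff≢0 g g≡ (begin
      coeff g k              ≡⟨ +-identityˡ _ ⟨
      0# + coeff g k         ≡⟨ cong (_+ coeff g k) (size≤⇒coeff≡0 f (ℕ.≤-pred f<g)) ⟨
      coeff f k + coeff g k  ≡⟨ coeff-+ₚ f g k ⟨
      coeff (f +ₚ g) k       ≡⟨ fgk≡0 ⟩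
      0#                     ∎)

  size-*ₚ : ∀ f g {a b} → size f ≡ suc a → size g ≡ suc b → size (f *ₚ g) ≡ suc (a ℕ.+ b)
  size-*ₚ (c ∷ f) g {a} {b} c∷f≡ g≡ with size f in f≡ | c ≟ 0#
  size-*ₚ (c ∷ f) g {zero} {b} c∷f≡ g≡ | zero | no c≢0 =
    trans (size-cong (≋-trans (+ₚ-cong (≋-refl {scale c g}) f·g≋0) (+ₚ-identityʳ (scale c g))))
          (size-scale g c≢0 g≡)
    where
    f·g≋0 : 0# ∷ (f *ₚ g) ≋ []
    f·g≋0 = ≋-trans (shift-cong (*ₚ-zeroˡ g (size≡0⇒≋[] f f≡))) shift-[]
  size-*ₚ (c ∷ f) g {suc a} {b} refl g≡ | suc a | _ = begin
    size (scale c g +ₚ (0# ∷ (f *ₚ g)))  ≡⟨ size-+ₚ-< (scale c g) (0# ∷ (f *ₚ g)) c·g<x·f·g ⟩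
    size (0# ∷ (f *ₚ g))                 ≡⟨ x·f·g≡ ⟩
    suc (suc (a ℕ.+ b))                  ∎
    where
    x·f·g≡ : size (0# ∷ (f *ₚ g)) ≡ suc (suc (a ℕ.+ b))
    x·f·g≡ = size-∷ 0# {f *ₚ g} (size-*ₚ f g f≡ g≡)
    c·g<x·f·g : size (scale c g) < size (0# ∷ (f *ₚ g))
    c·g<x·f·g = subst (size (scale c g) <_) (sym x·f·g≡)
      (s≤s (≤-trans (size-scale≤ c g) (subst (_≤ suc (a ℕ.+ b)) (sym g≡) (s≤s (ℕ.m≤n+m b a)))))

  ∣ˡ⇒size≤ : ∀ {b a} → b ∣ˡ a → 0 < size a → size b ≤ size a
  ∣ˡ⇒size≤ {b} {a} (t , bt≋a) 0<a with size b in b≡ | size t in t≡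
  ... | zero  | _     = z≤n
  ... | suc j | zero  = contradiction (trans (sym (size-cong bt≋a)) (size-cong b·t≋0)) (ℕ.n>0⇒n≢0 0<a)
    where
    b·t≋0 : b *ₚ t ≋ []
    b·t≋0 = ≋-trans (*ₚ-congˡ b (size≡0⇒≋[] t t≡)) (*ₚ-zeroʳ b)
  ... | suc j | suc k =
    subst (suc j ≤_) (trans (sym (size-*ₚ b t b≡ t≡)) (size-cong bt≋a)) (s≤s (ℕ.m≤m+n j k))

  -- Division with remainder and Bézout's identity

  monomial : ℕ → Carrier → Poly
  monomial zero    c = [ c ]
  monomial (suc e) c = 0# ∷ monomial e c

  coeff-*ₚ-monomial : ∀ b e c i → coeff (b *ₚ monomial e c) (e ℕ.+ i) ≡ c * coeff b i
  coeff-*ₚ-monomial b zero    c i = trans (coeff-≡ (*ₚ-constʳ b c) i) (coeff-scale c b i)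
  coeff-*ₚ-monomial b (suc e) c i =
    trans (coeff-≡ (*ₚ-shiftʳ b (monomial e c)) (suc (e ℕ.+ i))) (coeff-*ₚ-monomial b e c i)

  vanishesFrom-+ : ∀ {f} e m → (∀ i → m ≤ i → coeff f (e ℕ.+ i) ≡ 0#) → VanishesFrom (e ℕ.+ m) f
  vanishesFrom-+ {f} e m f≡0 i e+m≤i =
    subst (λ k → coeff f k ≡ 0#) (ℕ.m+[n∸m]≡n e≤i) (f≡0 (i ∸ e) m≤i∸e)
    where
    e≤i : e ≤ i
    e≤i = ≤-trans (ℕ.m≤m+n e m) e+m≤i
    m≤i∸e : m ≤ i ∸ e
    m≤i∸e = ℕ.+-cancelˡ-≤ e m (i ∸ e) (subst (e ℕ.+ m ≤_) (sym (ℕ.m+[n∸m]≡n e≤i)) e+m≤i)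

  -- Subtracting (lead a / lead b) xᵉ b, with e = deg a − deg b, kills the leading term of a.
  cancel-leading : ∀ a b → 0 < size b → size b ≤ size a → ∃ λ t → size (a -ₚ (b *ₚ t)) < size a
  cancel-leading a b 0<b b≤a with size a in a≡ | size b in b≡
  ... | suc j | suc m = t , s≤s (vanishes⇒size≤ (a -ₚ (b *ₚ t))
                                  (subst (λ N → VanishesFrom N (a -ₚ (b *ₚ t))) e+m≡j
                                         (vanishesFrom-+ {a -ₚ (b *ₚ t)} e m vanishes)))
    where
    e = j ∸ m
    e+m≡j : e ℕ.+ m ≡ j
    e+m≡j = ℕ.m∸n+n≡m (ℕ.≤-pred b≤a)
    lb⁻¹ : Carrier
    lb⁻¹ = proj₁ (inverse (coeff b m) (size≡suc⇒coeff≢0 b b≡))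
    s = coeff a j * lb⁻¹
    t = monomial e s
    s·lb≡la : s * coeff b m ≡ coeff a j
    s·lb≡la = begin
      (coeff a j * lb⁻¹) * coeff b m  ≡⟨ *-assoc _ _ _ ⟩
      coeff a j * (lb⁻¹ * coeff b m)  ≡⟨ cong (coeff a j *_) (trans (*-comm _ _) (proj₂ (inverse _ _))) ⟩
      coeff a j * 1#                  ≡⟨ *-identityʳ _ ⟩
      coeff a j                       ∎
    coeff-a-bt : ∀ i → coeff (a -ₚ (b *ₚ t)) (e ℕ.+ i) ≡ coeff a (e ℕ.+ i) + - (s * coeff b i)
    coeff-a-bt i = trans (coeff-+ₚ a _ (e ℕ.+ i)) (cong (coeff a (e ℕ.+ i) +_)
                     (trans (coeff-negₚ (b *ₚ t) (e ℕ.+ i)) (cong -_ (coeff-*ₚ-monomial b e s i))))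
    vanishes : ∀ i → m ≤ i → coeff (a -ₚ (b *ₚ t)) (e ℕ.+ i) ≡ 0#
    vanishes i m≤i with ℕ.m≤n⇒m<n∨m≡n m≤i
    ... | inj₂ refl = begin
      coeff (a -ₚ (b *ₚ t)) (e ℕ.+ m)        ≡⟨ coeff-a-bt m ⟩
      coeff a (e ℕ.+ m) + - (s * coeff b m)  ≡⟨ cong₂ (λ k c → coeff a k + - c) e+m≡j s·lb≡la ⟩
      coeff a j + - coeff a j                ≡⟨ -‿inverseʳ _ ⟩
      0#                                     ∎
    ... | inj₁ m<i = begin
      coeff (a -ₚ (b *ₚ t)) (e ℕ.+ i)        ≡⟨ coeff-a-bt i ⟩
      coeff a (e ℕ.+ i) + - (s * coeff b i)  ≡⟨ cong₂ (λ x y → x + - (s * y))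
                                                        (size≤⇒coeff≡0 a a≤e+i)
                                                        (size≤⇒coeff≡0 b (subst (_≤ i) (sym b≡) m<i)) ⟩
      0# + - (s * 0#)                        ≡⟨ cong (λ x → 0# + - x) (zeroʳ s) ⟩
      0# + - 0#                              ≡⟨ -‿inverseʳ 0# ⟩
      0#                                     ∎
      where
      a≤e+i : size a ≤ e ℕ.+ i
      a≤e+i = subst (_≤ e ℕ.+ i) (trans (trans (ℕ.+-suc e m) (cong suc e+m≡j)) (sym a≡))
                    (ℕ.+-monoʳ-≤ e m<i)

  record Division (a b : Poly) : Set where
    constructor division
    field
      quotient remainder : Poly
      a≋bq+r             : a ≋ (b *ₚ quotient) +ₚ remainder
      remainder<divisor  : size remainder < size b

  divide : ∀ a b → 0 < size b → Division a b
  divide a b 0<b = go (size a) a ≤-refl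
    where
    go : ∀ N a → size a ≤ N → Division a b
    go N a a≤N with size a ℕ.<? size b
    ... | yes a<b = division [] a (≋-sym (+ₚ-cong (*ₚ-zeroʳ b) ≋-refl)) a<b
    ... | no a≮b with cancel-leading a b 0<b (ℕ.≮⇒≥ a≮b) | N
    ...   | _ , _ | zero = contradiction (≤-trans 0<b (≤-trans (ℕ.≮⇒≥ a≮b) a≤N)) λ ()
    ...   | t , smaller | suc N with go N (a -ₚ (b *ₚ t)) (ℕ.≤-pred (≤-trans smaller a≤N))
    ...     | division q r a-bt≋bq+r r<b =
      division (t +ₚ q) r (x-bt≈bq+r⇒x≈b[t+q]+r {b = b} {t} a-bt≋bq+r) r<b

  record Bezout (x y : Poly) : Set where
    field
      gcd             : Poly
      gcd-combination : LinearCombination x y gcd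
      gcd∣ˡx          : gcd ∣ˡ x
      gcd∣ˡy          : gcd ∣ˡ y
      0<size-gcd      : 0 < size gcd

  -- A nonzero combination of least size divides x and y: otherwise a remainder would be smaller.
  bezout : ∀ x y → 0 < size x → Bezout x y
  bezout x y 0<x = descend (size x) x (combinationˡ x y) 0<x ≤-refl
    where
    descend : ∀ N d → LinearCombination x y d → 0 < size d → size d ≤ N → Bezout x y
    descend zero    d _        0<d d≤0 = contradiction d≤0 (ℕ.<⇒≱ 0<d)
    descend (suc N) d d-comb 0<d d≤N
      with divide x d 0<d | divide y d 0<d
    ... | division qx rx x≋dq+r rx<d | division qy ry y≋dq+r ry<d
      with size rx ℕ.≟ 0 | size ry ℕ.≟ 0
    ... | no rx≢0 | _ = descend N rx (combination-remainder (combinationˡ x y) d-comb x≋dq+r)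
                                     (ℕ.n≢0⇒n>0 rx≢0) (ℕ.≤-pred (≤-trans rx<d d≤N))
    ... | yes _ | no ry≢0 = descend N ry (combination-remainder (combinationʳ x y) d-comb y≋dq+r)
                                         (ℕ.n≢0⇒n>0 ry≢0) (ℕ.≤-pred (≤-trans ry<d d≤N))
    ... | yes rx≡0 | yes ry≡0 = record
      { gcd             = d
      ; gcd-combination = d-comb
      ; gcd∣ˡx          = zero-remainder⇒∣ˡ x≋dq+r (size≡0⇒≋[] rx rx≡0)
      ; gcd∣ˡy          = zero-remainder⇒∣ˡ y≋dq+r (size≡0⇒≋[] ry ry≡0)
      ; 0<size-gcd      = 0<d
      }

  ∣ˡ-dec : ∀ b a → 0 < size b → Dec (b ∣ˡ a)
  ∣ˡ-dec b a 0<b with divide a b 0<b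
  ... | division q r a≋bq+r r<b with size r ℕ.≟ 0
  ...   | yes r≡0 = yes (zero-remainder⇒∣ˡ a≋bq+r (size≡0⇒≋[] r r≡0))
  ...   | no r≢0  = no λ b∣a →
    ℕ.<⇒≱ r<b (∣ˡ⇒size≤ (∣ˡ-remainder a≋bq+r b∣a) (ℕ.n≢0⇒n>0 r≢0))

  -- Monic polynomials and their gcds

  coeff-monic : ∀ {k} (c : Vec Carrier k) → coeff (monic c) k ≡ 1#
  coeff-monic []      = refl
  coeff-monic (_ ∷ c) = coeff-monic c

  monic-vanishes : ∀ {k} (c : Vec Carrier k) → VanishesFrom (suc k) (monic c)
  monic-vanishes []      (suc i) _         = refl
  monic-vanishes (_ ∷ c) (suc i) (s≤s k<i) = monic-vanishes c i k<i

  size-monic : ∀ {k} (c : Vec Carrier k) → size (monic c) ≡ suc k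
  size-monic c = size-exact (monic c) (monic-vanishes c) λ ck≡0 → 1#≢0# (trans (sym (coeff-monic c)) ck≡0)

  0<size-monic : ∀ {k} (c : Vec Carrier k) → 0 < size (monic c)
  0<size-monic c = subst (0 <_) (sym (size-monic c)) (s≤s z≤n)

  monic-injective : ∀ {k} (c c′ : Vec Carrier k) → monic c ≋ monic c′ → c ≡ c′
  monic-injective []      []        _     = refl
  monic-injective (a ∷ c) (a′ ∷ c′) c≋c′ =
    cong₂ _∷_ (coeff-≡ c≋c′ zero) (monic-injective c c′ (coeffwise (coeff-≡ c≋c′ ∘ suc)))

  monic-−-vanishes : ∀ {n} (c c′ : Vec Carrier n) → VanishesFrom n (monic c -ₚ monic c′)
  monic-−-vanishes {n} c c′ i n≤i = begin
    coeff (monic c -ₚ monic c′) i              ≡⟨ coeff-+ₚ (monic c) _ i ⟩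
    coeff (monic c) i + coeff (negₚ (monic c′)) i ≡⟨ cong₂ _+_ top-agree (coeff-negₚ (monic c′) i) ⟩
    coeff (monic c′) i + - coeff (monic c′) i  ≡⟨ -‿inverseʳ _ ⟩
    0#                                         ∎
    where
    top-agree : coeff (monic c) i ≡ coeff (monic c′) i
    top-agree with ℕ.m≤n⇒m<n∨m≡n n≤i
    ... | inj₂ refl = trans (coeff-monic c) (sym (coeff-monic c′))
    ... | inj₁ n<i  = trans (monic-vanishes c i n<i) (sym (monic-vanishes c′ i n<i))

  coeffs : ∀ k → Poly → Vec Carrier k
  coeffs zero    _       = []
  coeffs (suc k) []      = 0# ∷ coeffs k []
  coeffs (suc k) (a ∷ f) = a ∷ coeffs k f

  coeffs-≋ : ∀ k f → VanishesFrom k f → toList (coeffs k f) ≋ f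
  coeffs-≋ zero    f       f≡0 = coeffwise λ i → sym (f≡0 i z≤n)
  coeffs-≋ (suc k) []      _   = coeffwise λ where
    zero    → refl
    (suc i) → coeff-≡ (coeffs-≋ k [] λ _ _ → refl) i
  coeffs-≋ (suc k) (a ∷ f) f≡0 = coeffwise λ where
    zero    → refl
    (suc i) → coeff-≡ (coeffs-≋ k f λ j k≤j → f≡0 (suc j) (s≤s k≤j)) i

  monic-coeffs : ∀ k f → VanishesFrom (suc k) f → coeff f k ≡ 1# → monic (coeffs k f) ≋ f
  monic-coeffs _       []      _   0≡1 = contradiction 0≡1 0≢1
  monic-coeffs zero    (a ∷ f) f≡0 a≡1 = coeffwise λ where
    zero    → sym a≡1
    (suc i) → sym (f≡0 (suc i) (s≤s z≤n))
  monic-coeffs (suc k) (a ∷ f) f≡0 fk≡1 = coeffwise λ where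
    zero    → refl
    (suc i) → coeff-≡ (monic-coeffs k f (λ j k<j → f≡0 (suc j) (s≤s k<j)) fk≡1) i

  const-*ₚ-const : ∀ {a b c} → a * b ≡ c → [ a ] *ₚ [ b ] ≋ [ c ]
  const-*ₚ-const ab≡c = coeffwise λ where
    zero    → trans (+-identityʳ _) ab≡c
    (suc i) → refl

  monic-associate : ∀ h → 0 < size h → ∃₂ λ k (d : Vec Carrier k) → monic d ∣ˡ h × h ∣ˡ monic d
  monic-associate h 0<h with size h in h≡
  ... | suc k = k , coeffs k g , ([ c ] , d·c≋h) , ([ c⁻¹ ] , ≋-sym d≋g)
    where
    c = coeff h k
    c⁻¹ = proj₁ (inverse c (size≡suc⇒coeff≢0 h h≡))
    c·c⁻¹≡1 : c * c⁻¹ ≡ 1#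
    c·c⁻¹≡1 = proj₂ (inverse c (size≡suc⇒coeff≢0 h h≡))
    g = h *ₚ [ c⁻¹ ]
    coeff-g : ∀ i → coeff g i ≡ c⁻¹ * coeff h i
    coeff-g i = trans (coeff-≡ (*ₚ-constʳ h c⁻¹) i) (coeff-scale c⁻¹ h i)
    d≋g : monic (coeffs k g) ≋ g
    d≋g = monic-coeffs k g
      (λ i k<i → trans (coeff-g i)
                   (trans (cong (c⁻¹ *_) (size≤⇒coeff≡0 h (subst (_≤ i) (sym h≡) k<i))) (zeroʳ c⁻¹)))
      (trans (coeff-g k) (trans (*-comm c⁻¹ c) c·c⁻¹≡1))
    d·c≋h : monic (coeffs k g) *ₚ [ c ] ≋ h
    d·c≋h = x≈y*u⇒x*v≈y (const-*ₚ-const (trans (*-comm c⁻¹ c) c·c⁻¹≡1)) d≋g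

  monic-gcd : ∀ x y → 0 < size x → ∃₂ λ k (d : Vec Carrier k) → IsMonicGCD d x y
  monic-gcd x y 0<x =
    let k , d , d∣gcd , gcd∣d = monic-associate gcd 0<size-gcd
    in k , d , ∣ˡ⇒∣ₚ (∣ˡ-trans d∣gcd gcd∣ˡx) , ∣ˡ⇒∣ₚ (∣ˡ-trans d∣gcd gcd∣ˡy) ,
       λ e e∣x e∣y →
         ∣ˡ⇒∣ₚ (∣ˡ-trans (∣ˡ-combination (∣ₚ⇒∣ˡ {e} e∣x) (∣ₚ⇒∣ˡ {e} e∣y) gcd-combination)
                         gcd∣d)
    where open Bezout (bezout x y 0<x)

  irreducible⇒coprime : ∀ {f g} → Irreducible f → ¬ f ∣ˡ g → Coprime f g
  irreducible⇒coprime {f} {g} (f≉0 , _ , factors) f∤g = coprime (bezout f g (≉[]⇒0<size f≉0))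
    where
    coprime : Bezout f g → Coprime f g
    coprime record { gcd = h ; gcd-combination = h-comb ; gcd∣ˡx = w , h·w≋f ; gcd∣ˡy = h∣g }
      with factors h w (≋⇒≈ₚ (≋-sym h·w≋f))
    ... | inj₁ (z , h·z≈1) = combination-resp (≈ₚ⇒≋ h·z≈1) (combination-*ʳ z h-comb)
    ... | inj₂ (z , w·z≈1) =
      contradiction (∣ˡ-trans (z , x≈y*u⇒x*v≈y (≈ₚ⇒≋ w·z≈1) (≋-sym h·w≋f)) h∣g) f∤g

  -- f and the gcd d are coprime and both divide p₁ − p₂ ≠ 0, so deg f + deg d ≤ deg (p₁ − p₂) < n.
  gcd-size-bound : ∀ {m k n} {f : Vec Carrier m} {d : Vec Carrier k} {p₁ p₂ : Vec Carrier n} →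
                   Irreducible (monic f) → p₁ ≢ p₂ →
                   monic f ∣ˡ (monic p₁ -ₚ monic p₂) → ¬ monic f ∣ˡ monic p₁ →
                   IsMonicGCD d (monic p₁) (monic p₂) → m ℕ.+ k < n
  gcd-size-bound {m} {k} {n} {f} {d} {p₁} {p₂}
                 f-irreducible p₁≢p₂ f∣p₁-p₂ f∤p₁ (d∣p₁ , d∣p₂ , _) =
    subst (_≤ n) (size-*ₚ (monic f) (monic d) (size-monic f) (size-monic d))
      (≤-trans (∣ˡ⇒size≤ fd∣p₁-p₂ 0<size-p₁-p₂)
               (vanishes⇒size≤ (monic p₁ -ₚ monic p₂) (monic-−-vanishes p₁ p₂)))
    where
    d∣p₁-p₂ : monic d ∣ˡ (monic p₁ -ₚ monic p₂)
    d∣p₁-p₂ = ∣ˡ-− (∣ₚ⇒∣ˡ d∣p₁) (∣ₚ⇒∣ˡ d∣p₂)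
    f∤d : ¬ monic f ∣ˡ monic d
    f∤d f∣d = f∤p₁ (∣ˡ-trans f∣d (∣ₚ⇒∣ˡ d∣p₁))
    fd∣p₁-p₂ : monic f *ₚ monic d ∣ˡ (monic p₁ -ₚ monic p₂)
    fd∣p₁-p₂ = coprime-∣ˡ⇒*∣ˡ (irreducible⇒coprime f-irreducible f∤d) f∣p₁-p₂ d∣p₁-p₂
    0<size-p₁-p₂ : 0 < size (monic p₁ -ₚ monic p₂)
    0<size-p₁-p₂ = ℕ.n≢0⇒n>0 λ size≡0 →
      p₁≢p₂ (monic-injective p₁ p₂
              (x∙y⁻¹≈ε⇒x≈y (monic p₁) (monic p₂) (size≡0⇒≋[] _ size≡0)))
  -- Residues modulo f

  encode : ∀ {k} → Vec Carrier k → Fin (q ^ k)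
  encode []      = Fin.zero
  encode (a ∷ c) = Fin.combine (from a) (encode c)

  encode-injective : ∀ {k} (c c′ : Vec Carrier k) → encode c ≡ encode c′ → c ≡ c′
  encode-injective []      []        _  = refl
  encode-injective (a ∷ c) (a′ ∷ c′) eq =
    let a≡a′ , c≡c′ = Fin.combine-injective (from a) (encode c) (from a′) (encode c′) eq
    in cong₂ _∷_ (from-injective a≡a′) (encode-injective c c′ c≡c′)

  -- The remainder of a modulo f, coded as one of the q ^ deg f polynomials of degree < deg f.
  residue : ∀ {m} → Vec Carrier m → Poly → Fin (q ^ m)
  residue {m} f a = encode (coeffs m (Division.remainder (divide a (monic f) (0<size-monic f))))

  residue-≡⇒∣ˡ : ∀ {m} (f : Vec Carrier m) a b → residue f a ≡ residue f b → monic f ∣ˡ (a -ₚ b)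
  residue-≡⇒∣ˡ {m} f a b same =
    ∣ˡ-difference a≋fq+r (≋-trans b≋fq+r (+ₚ-cong ≋-refl (≋-sym rₐ≋r_b)))
    where
    open Division (divide a (monic f) (0<size-monic f))
      renaming (remainder to rₐ; a≋bq+r to a≋fq+r; remainder<divisor to rₐ<f)
    open Division (divide b (monic f) (0<size-monic f))
      renaming (remainder to r_b; a≋bq+r to b≋fq+r; remainder<divisor to r_b<f)
    below-m : ∀ {r} → size r < size (monic f) → VanishesFrom m r
    below-m {r} r<f = size≤⇒vanishes r (ℕ.≤-pred (subst (size r <_) (size-monic f) r<f))
    rₐ≋r_b : rₐ ≋ r_b
    rₐ≋r_b = ≋-trans (≋-sym (coeffs-≋ m rₐ (below-m {rₐ} rₐ<f)))
             (subst (λ c → toList c ≋ r_b) (sym (encode-injective _ _ same))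
                    (coeffs-≋ m r_b (below-m {r_b} r_b<f)))

  distinct-members-have-distinct-residues :
    ∀ {n ℓ} {𝓕 : List (Vec Carrier n)} {f : Vec Carrier (n ∸ ℓ)} → ℓ ≤ n →
    Intersecting ℓ 𝓕 → Irreducible (monic f) →
    ∀ {p₁ p₂} → p₁ ∈ 𝓕 → p₂ ∈ 𝓕 → p₁ ≢ p₂ → ¬ monic f ∣ˡ monic p₁ →
    residue f (monic p₁) ≢ residue f (monic p₂)
  distinct-members-have-distinct-residues {n} {ℓ} {f = f} ℓ≤n 𝓕-intersecting f-irreducible {p₁} {p₂}
    p₁∈𝓕 p₂∈𝓕 p₁≢p₂ f∤p₁ same =
    gcd-too-large (monic-gcd (monic p₁) (monic p₂) (0<size-monic p₁))
    where
    gcd-too-large : ¬ ∃₂ λ k (d : Vec Carrier k) → IsMonicGCD d (monic p₁) (monic p₂)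
    gcd-too-large (k , d , d-gcd) = ℕ.<⇒≱ [n∸ℓ]+k<n n≤[n∸ℓ]+k
      where
      [n∸ℓ]+k<n : (n ∸ ℓ) ℕ.+ k < n
      [n∸ℓ]+k<n = gcd-size-bound {f = f} {d} {p₁} {p₂} f-irreducible p₁≢p₂
                    (residue-≡⇒∣ˡ f (monic p₁) (monic p₂) same) f∤p₁ d-gcd
      n≤[n∸ℓ]+k : n ≤ (n ∸ ℓ) ℕ.+ k
      n≤[n∸ℓ]+k = subst (_≤ (n ∸ ℓ) ℕ.+ k) (ℕ.m∸n+n≡m ℓ≤n)
                    (ℕ.+-monoʳ-≤ (n ∸ ℓ) (𝓕-intersecting p₁∈𝓕 p₂∈𝓕 k d d-gcd))

lemma1 : (q : ℕ) (F : FiniteField q) (n ℓ : ℕ) → ℓ ≤ n →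
    (𝓕 : List (Vec (FiniteField.Carrier F) n)) → Unique 𝓕 →
    PolyOver.Intersecting F ℓ 𝓕 → length 𝓕 ≡ q ^ (n ∸ ℓ) →
    (f : Vec (FiniteField.Carrier F) (n ∸ ℓ)) →
    PolyOver.Irreducible F (PolyOver.monic F f) →
    Σ (Vec (FiniteField.Carrier F) n) λ p →
      (p ∈ 𝓕) × PolyOver._∣ₚ_ F (PolyOver.monic F f) (PolyOver.monic F p)
lemma1 q F n ℓ ℓ≤n 𝓕 𝓕-unique 𝓕-intersecting |𝓕| f f-irreducible =
  search (any? (λ p → ∣ˡ-dec (monic f) (monic p) (0<size-monic f)) 𝓕)
  where
  open FiniteField F using (Carrier)
  open PolyOver F
  open Polynomials F

  search : Dec (Any (λ p → monic f ∣ˡ monic p) 𝓕) →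
           Σ (Vec Carrier n) λ p → (p ∈ 𝓕) × monic f ∣ₚ monic p
  search (yes found) = let p , p∈𝓕 , f∣p = find found in p , p∈𝓕 , ∣ˡ⇒∣ₚ f∣p
  search (no none) = contradiction collision no-collision
    where
    f∤ : ∀ {p} → p ∈ 𝓕 → ¬ monic f ∣ˡ monic p
    f∤ p∈𝓕 f∣p = none (lose p∈𝓕 f∣p)
    avoids : All (λ p → residue f (monic p) ≢ residue f []) 𝓕
    avoids = All.tabulate λ {p} p∈𝓕 →
      f∤ p∈𝓕 ∘ ∣ˡ-respʳ-≈ (+ₚ-identityʳ (monic p)) ∘ residue-≡⇒∣ˡ f (monic p) []
    Collision : Set
    Collision = ∃₂ λ p₁ p₂ → p₁ ∈ 𝓕 × p₂ ∈ 𝓕 × p₁ ≢ p₂ ×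
                             residue f (monic p₁) ≡ residue f (monic p₂)
    collision : Collision
    collision = pigeonhole-avoiding 𝓕-unique |𝓕| (residue f ∘ monic) (residue f []) avoids
    no-collision : ¬ Collision
    no-collision (p₁ , p₂ , p₁∈𝓕 , p₂∈𝓕 , p₁≢p₂ , same) =
      distinct-members-have-distinct-residues ℓ≤n 𝓕-intersecting f-irreducible
        p₁∈𝓕 p₂∈𝓕 p₁≢p₂ (f∤ p₁∈𝓕) same
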